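{- For $i \in \{1,2\}$, the maximum $i$-level cut of the (unreduced) output of Apply of $f$ and $g$ is at most $C_{i:f} \cdot C_{i:g}$.
   Context: A Binary Decision Diagram (BDD) $f$ is an ordered (w.r.t. the identity variable ordering) DAG $(V,A)$ with a single root, terminal sinks in $\{\bot,\top\}$, and internal nodes $v$ each labelled by a variable index $\mathit{label}(v)$ and having exactly two outgoing arcs (low and high). A levelisation of a DAG $(V,A)$ is a function $\mathcal{L} : V \to \mathbb{N}\cup\{\infty\}$ with $\mathcal{L}(v) < \mathcal{L}(v')$ whenever $v \to v' \in A$. For BDDs the levelisation used is $\mathcal{L}_{\mathrm{BDD}}(v) = \mathit{label}(v)$ if $v$ is an internal node and $\mathcal{L}_{\mathrm{BDD}}(v) = \infty$ if $v$ is a terminal. A cut $(S,T)$ of $(V,A)$ is a partition of $V$; its (unweighted) size is the number of arcs from $S$ to $T$. An $i$-level cut (for $i \geq 1$) is a cut $(S,T)$ for which there exists $j \in \mathbb{N}$ with $\mathcal{L}(s) < j+i$ for all $s \in S$ and $\mathcal{L}(t) > j$ for all $t \in T$. $C_{i:f}$ denotes the size of the unweighted maximum $i$-level cut (w.r.t. $\mathcal{L}_{\mathrm{BDD}}$) of the DAG of $f$, where an extra arc $(-\infty) \to r_f$ into the root $r_f$ is added so every node has at least one incoming arc. Apply, given BDDs $f,g$ and a binary Boolean operator $\odot$, computes $f \odot g$ by a product construction starting from the pair of roots $(r_f,r_g)$: pairs of terminals $(b_f,b_g)$ yield terminal $b_f \odot b_g$; otherwise a pair $(v_f,v_g)$ yields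 a node with label $\ell = \min(\mathit{label}(v_f),\mathit{label}(v_g))$ whose low (resp. high) child is the pair obtained by replacing each component whose label equals $\ell$ by its low (resp. high) child and keeping the other component unchanged. The output of this product construction, before applying the BDD reduction rules, is the unreduced output. -}

module Defs where

open import Data.Nat using (ℕ; _<_; _≡ᵇ_; _⊓_)
open import Data.Fin using (Fin)
open import Data.Bool using (Bool; true; false; if_then_else_)
open import Data.Maybe using (Maybe; just; nothing)
open import Data.Product using (Σ; _×_; _,_)
open import Data.Unit using (⊤)
open import Data.Empty using (⊥)
open import Data.List using (List; length)
open import Data.List.Membership.Propositional using (_∈_)
open import Data.List.Relation.Unary.Unique.Propositional using (Unique)
open import Function.Bundles using (_⇔_)
open import Relation.Binary.PropositionalEquality using (_≡_)

-- Levels: -∞ (only for the extra source vertex), finite, ∞ (terminals)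

data Lvl : Set where
  -∞  : Lvl
  fin : ℕ → Lvl
  ∞   : Lvl

_<ᴸ_ : Lvl → ℕ → Set
-∞    <ᴸ m = ⊤
fin n <ᴸ m = n < m
∞     <ᴸ m = ⊥

_<ᴿ_ : ℕ → Lvl → Set
j <ᴿ -∞    = ⊥
j <ᴿ fin n = j < n
j <ᴿ ∞     = ⊤

-- The vertex set is the set of nodes reachable from the root; an extra
-- vertex -∞ (represented by 'nothing') with an arc into the root is added.

record LDAG : Set₁ where
  field
    Node     : Set
    root     : Node
    level    : Node → Lvl
    -- children v = just (low , high) for internal v, nothing for terminals
    children : Node → Maybe (Node × Node)

module _ (G : LDAG) where
  open LDAG G

  child : Node → Bool → Maybe Node
  child v b with children v
  ... | just (l , h) = just (if b then h else l)
  ... | nothing      = nothing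

  data Reach : Node → Set where
    reach-root : Reach root
    reach-step : ∀ {v w} (b : Bool) → Reach v → child v b ≡ just w → Reach w

  Vx : Set
  Vx = Maybe Node

  InV : Vx → Set
  InV nothing  = ⊤
  InV (just v) = Reach v

  levelx : Vx → Lvl
  levelx nothing  = -∞
  levelx (just v) = level v

  -- arcs: the extra arc -∞ → root, and the low/high arcs out of a node
  data Arc : Set where
    start : Arc
    out   : Node → Bool → Arc

  -- a cut (S , T) is given by its characteristic function (true = in S)
  Cut : Set
  Cut = Vx → Bool

  Crossing : Cut → Arc → Set
  Crossing S start     = (S nothing ≡ true) × (S (just root) ≡ false)
  Crossing S (out v b) = Reach v × Σ Node λ w →
    (child v b ≡ just w) × (S (just v) ≡ true) × (S (just w) ≡ false)

  CutSize : Cut → ℕ → Set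
  CutSize S k = Σ (List Arc) λ l →
    Unique l × (∀ a → (a ∈ l) ⇔ Crossing S a) × (length l ≡ k)

  IsLevelCut : ℕ → Cut → Set
  IsLevelCut i S = Σ ℕ λ j →
    (∀ s → InV s → S s ≡ true  → levelx s <ᴸ (j Data.Nat.+ i)) ×
    (∀ t → InV t → S t ≡ false → j <ᴿ levelx t)

  IsMaxLevelCut : ℕ → ℕ → Set
  IsMaxLevelCut i m =
    (Σ Cut λ S → IsLevelCut i S × CutSize S m) ×
    (∀ S k → IsLevelCut i S → CutSize S k → k Data.Nat.≤ m)

data Ptr (n : ℕ) : Set where
  leaf : Bool → Ptr n
  node : Fin n → Ptr n

-- label of a pointer target; nothing stands for ∞ (terminal)
module _ {n : ℕ} (label : Fin n → ℕ) where
  ptrLabel : Ptr n → Maybe ℕ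
  ptrLabel (leaf _) = nothing
  ptrLabel (node k) = just (label k)

  OrderedArc : Fin n → Ptr n → Set
  OrderedArc i (leaf _) = ⊤
  OrderedArc i (node k) = label i < label k

record BDD : Set where
  field
    size    : ℕ
    label   : Fin size → ℕ
    low     : Fin size → Ptr size
    high    : Fin size → Ptr size
    root    : Ptr size
    ordered : ∀ i → OrderedArc label i (low i) × OrderedArc label i (high i)

toLvl : Maybe ℕ → Lvl
toLvl nothing  = ∞
toLvl (just n) = fin n

bddDAG : BDD → LDAG
bddDAG f = record
  { Node     = Ptr size
  ; root     = root
  ; level    = λ p → toLvl (ptrLabel label p)
  ; children = ch
  }
  where
  open BDD f
  ch : Ptr size → Maybe (Ptr size × Ptr size)
  ch (leaf _) = nothing
  ch (node k) = just (low k , high k)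

minLbl : Maybe ℕ → Maybe ℕ → Maybe ℕ
minLbl nothing  y        = y
minLbl (just x) nothing  = just x
minLbl (just x) (just y) = just (x ⊓ y)

module _ (f g : BDD) (op : Bool → Bool → Bool) where
  private
    module F = BDD f
    module G = BDD g

  data OutNode : Set where
    term : Bool → OutNode
    pair : Ptr F.size → Ptr G.size → OutNode

  embed : Ptr F.size → Ptr G.size → OutNode
  embed (leaf a) (leaf b) = term (op a b)
  embed p        q        = pair p q

  stepF : Bool → ℕ → Ptr F.size → Ptr F.size
  stepF b ℓ (leaf x) = leaf x
  stepF b ℓ (node k) =
    if F.label k ≡ᵇ ℓ then (if b then F.high k else F.low k) else node k

  stepG : Bool → ℕ → Ptr G.size → Ptr G.size
  stepG b ℓ (leaf x) = leaf x
  stepG b ℓ (node k) =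
    if G.label k ≡ᵇ ℓ then (if b then G.high k else G.low k) else node k

  pairLabel : Ptr F.size → Ptr G.size → Maybe ℕ
  pairLabel p q = minLbl (ptrLabel F.label p) (ptrLabel G.label q)

  outLevel : OutNode → Lvl
  outLevel (term _)   = ∞
  outLevel (pair p q) = toLvl (pairLabel p q)

  outChildren : OutNode → Maybe (OutNode × OutNode)
  outChildren (term _) = nothing
  outChildren (pair p q) with pairLabel p q
  ... | nothing = nothing
  ... | just ℓ  = just ( embed (stepF false ℓ p) (stepG false ℓ q)
                       , embed (stepF true  ℓ p) (stepG true  ℓ q) )

  applyDAG : LDAG
  applyDAG = record
    { Node     = OutNode
    ; root     = embed F.root G.root
    ; level    = outLevel
    ; children = outChildren
    }

-- Fix a maximum i-level cut of the product, with parameter j, and cut f and g at the same j,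
-- putting a node of level j+1 on the source side exactly when at most one arc from a node of
-- level ≤ j enters it. Each product arc crossing the cut is charged to a pair of crossing
-- arcs of f and g. If its target lies beyond level j, each component of the target was
-- entered from level ≤ j by an arc of f (resp. g) that crosses the cut, unless that
-- component was put on the source side, in which case its low arc does. Otherwise i = 2
-- and the source lies at level j+1, and each of its components at level j+1 offers two
-- crossing arcs, one per branch. The charge is injective: the arcs determine the product
-- node they are charged to, the branch, and (through the largest level of their sources)
-- the level of the step. So the cut of the product is at most |cut f| · |cut g| ≤ C_f · C_g.
module Submission where

open import Defs
open import Data.Nat using (ℕ; suc; _≤_; _<_; _*_; _+_; z≤n; s≤s; z<s; _≡ᵇ_; _≟_; _<?_; _≤?_)
open import Data.Nat.Properties
  using ( ≤-refl; ≤-reflexive; ≤-antisym; ≤-pred; <-irrefl; <-trans; <-≤-trans; <⇒≤; <⇒≱; ≰⇒>; ≤∧≢⇒<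
        ; n≤1+n; n<1+n; m<m+n; +-comm; *-mono-≤; ≡ᵇ⇒≡; ≡⇒≡ᵇ; ⊓-sel; ⊓-glb; m⊓n≤m; m⊓n≤n; module ≤-Reasoning)
open import Data.Fin using (Fin)
import Data.Fin.Properties as Fin
open import Data.Bool using (Bool; true; false; if_then_else_)
import Data.Bool.Properties as Bool
open import Data.Maybe using (Maybe; just; nothing)
open import Data.Maybe.Properties using (just-injective)
open import Data.Product using (∃; ∃₂; _×_; _,_; proj₁; proj₂)
open import Data.Product.Properties using (,-injective)
open import Data.Sum using (_⊎_; inj₁; inj₂; [_,_])
open import Data.Unit using (⊤; tt)
open import Data.Empty using (⊥; ⊥-elim)
open import Data.List using (List; []; _∷_; _++_; length; map; filter; cartesianProduct; deduplicate; allFin)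
open import Data.List.Properties using (length-++; length-map)
open import Data.List.Membership.Propositional using (_∈_)
open import Data.List.Membership.Propositional.Properties
  using (∈-map⁺; ∈-allFin; ∈-cartesianProduct⁺; ∈-deduplicate⁺; ∈-filter⁺; ∈-filter⁻)
open import Data.List.Relation.Unary.Any using (here; there)
import Data.List.Relation.Unary.All as All
open import Data.List.Relation.Unary.All using (_∷_)
open import Data.List.Relation.Unary.Unique.Propositional using (Unique; _∷_)
import Data.List.Relation.Unary.Unique.Propositional.Properties as Unique
import Data.List.Relation.Unary.Unique.DecPropositional.Properties as UniqueDec
open import Function.Bundles using (mk⇔; Equivalence)
open import Relation.Nullary using (Dec; yes; no; ¬_; does)
open import Relation.Nullary.Decidable using (map′; _⊎-dec_; _×-dec_; dec-true; dec-false)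
open import Relation.Binary.Definitions using (DecidableEquality)
open import Relation.Binary.PropositionalEquality
  using (_≡_; _≢_; refl; sym; trans; cong; cong₂; subst; subst₂; module ≡-Reasoning)

length-cartesianProduct : ∀ {A B : Set} (xs : List A) (ys : List B) →
  length (cartesianProduct xs ys) ≡ length xs * length ys
length-cartesianProduct []       ys = refl
length-cartesianProduct (x ∷ xs) ys = begin
  length (map (x ,_) ys ++ cartesianProduct xs ys)          ≡⟨ length-++ (map (x ,_) ys) ⟩
  length (map (x ,_) ys) + length (cartesianProduct xs ys)  ≡⟨ cong₂ _+_ (length-map (x ,_) ys) (length-cartesianProduct xs ys) ⟩
  length ys + length xs * length ys                         ∎
  where open ≡-Reasoning

∈-remove : ∀ {A : Set} {y : A} (ys : List A) → y ∈ ys →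
  ∃ λ ys′ → length ys ≡ suc (length ys′) × (∀ {z} → z ∈ ys → z ≢ y → z ∈ ys′)
∈-remove (_ ∷ ys) (here refl) = ys , refl , λ { (here refl) z≢y → ⊥-elim (z≢y refl) ; (there z∈ys) _ → z∈ys }
∈-remove (a ∷ ys) (there y∈ys) with ∈-remove ys y∈ys
... | ys′ , eq , keep = a ∷ ys′ , cong suc eq , λ { (here refl) _ → here refl ; (there z∈ys) z≢y → there (keep z∈ys z≢y) }

length-≤-injective : ∀ {A B : Set} (R : A → B → Set) (xs : List A) (ys : List B) → Unique xs →
  (∀ {x} → x ∈ xs → ∃ λ y → R x y × y ∈ ys) →
  (∀ {x x′ y} → R x y → R x′ y → x ≡ x′) →
  length xs ≤ length ys
length-≤-injective R []       ys _            _     _   = z≤n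
length-≤-injective R (x ∷ xs) ys (x∉xs ∷ uxs) image inj with image (here refl)
... | y , Rxy , y∈ys with ∈-remove ys y∈ys
...   | ys′ , eq , keep = subst (suc (length xs) ≤_) (sym eq) (s≤s (length-≤-injective R xs ys′ uxs image′ inj))
  where
  image′ : ∀ {x′} → x′ ∈ xs → ∃ λ y′ → R x′ y′ × y′ ∈ ys′
  image′ x′∈xs with image (there x′∈xs)
  ... | y′ , Rx′y′ , y′∈ys =
    y′ , Rx′y′ , keep y′∈ys λ { refl → All.lookup x∉xs x′∈xs (inj Rxy Rx′y′) }

between-levels : ∀ {i j ℓ} → i ≡ 1 ⊎ i ≡ 2 → ℓ < j + i → ¬ ℓ ≤ j → i ≡ 2 × ℓ ≡ suc j
between-levels {j = j} {ℓ} (inj₁ refl) ℓ<j+1 ℓ≰j = ⊥-elim (ℓ≰j (≤-pred (subst (ℓ <_) (+-comm j 1) ℓ<j+1)))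
between-levels {j = j} {ℓ} (inj₂ refl) ℓ<j+2 ℓ≰j = refl , ≤-antisym (≤-pred (subst (ℓ <_) (+-comm j 2) ℓ<j+2)) (≰⇒> ℓ≰j)

pick : ∀ {A : Set} → A → List A → Bool → A
pick d []          _     = d
pick d (x ∷ _)     false = x
pick d (_ ∷ [])    true  = d
pick d (_ ∷ y ∷ _) true  = y

pick-∈ : ∀ {A : Set} (d : A) xs b → 2 ≤ length xs → pick d xs b ∈ xs
pick-∈ d (x ∷ y ∷ _) false _ = here refl
pick-∈ d (x ∷ y ∷ _) true  _ = there (here refl)
pick-∈ d (_ ∷ [])    _     (s≤s ())

pick-injective : ∀ {A : Set} (d : A) xs → Unique xs → 2 ≤ length xs →
  ∀ b b′ → pick d xs b ≡ pick d xs b′ → b ≡ b′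
pick-injective d (x ∷ y ∷ _) _                 _ false false _   = refl
pick-injective d (x ∷ y ∷ _) ((x≢y ∷ _) ∷ _) _ false true  x≡y = ⊥-elim (x≢y x≡y)
pick-injective d (x ∷ y ∷ _) ((x≢y ∷ _) ∷ _) _ true  false y≡x = ⊥-elim (x≢y (sym y≡x))
pick-injective d (x ∷ y ∷ _) _                 _ true  true  _   = refl
pick-injective d (_ ∷ [])    _                 (s≤s ()) _ _ _

∈-length≤1 : ∀ {A : Set} {xs : List A} {x y} → length xs ≤ 1 → x ∈ xs → y ∈ xs → x ≡ y
∈-length≤1 {xs = _ ∷ []}    _        (here refl) (here refl) = refl
∈-length≤1 {xs = _ ∷ _ ∷ _} (s≤s ()) _           _

does-true : ∀ {P : Set} (P? : Dec P) → does P? ≡ true → P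
does-true (yes p) _ = p

does-false : ∀ {P : Set} (P? : Dec P) → does P? ≡ false → ¬ P
does-false (no ¬p) _ = ¬p

_≟ᵖ_ : ∀ {n} → DecidableEquality (Ptr n)
leaf a ≟ᵖ leaf b = map′ (cong leaf) (λ { refl → refl }) (a Bool.≟ b)
node k ≟ᵖ node l = map′ (cong node) (λ { refl → refl }) (k Fin.≟ l)
leaf _ ≟ᵖ node _ = no λ ()
node _ ≟ᵖ leaf _ = no λ ()

_≤∞_ : ℕ → Maybe ℕ → Set
ℓ ≤∞ nothing = ⊤
ℓ ≤∞ just n  = ℓ ≤ n

_<∞_ : ℕ → Maybe ℕ → Set
ℓ <∞ m = ℓ <ᴿ toLvl m

minLbl-≤∞ : ∀ a b {ℓ} → minLbl a b ≡ just ℓ → ℓ ≤∞ a × ℓ ≤∞ b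
minLbl-≤∞ nothing  (just y) refl = tt , ≤-refl
minLbl-≤∞ (just x) nothing  refl = ≤-refl , tt
minLbl-≤∞ (just x) (just y) refl = m⊓n≤m x y , m⊓n≤n x y

minLbl-sel : ∀ a b {ℓ} → minLbl a b ≡ just ℓ → a ≡ just ℓ ⊎ b ≡ just ℓ
minLbl-sel nothing  (just y) refl = inj₂ refl
minLbl-sel (just x) nothing  refl = inj₁ refl
minLbl-sel (just x) (just y) refl with ⊓-sel x y
... | inj₁ x⊓y≡x = inj₁ (cong just (sym x⊓y≡x))
... | inj₂ x⊓y≡y = inj₂ (cong just (sym x⊓y≡y))

<∞-minLbl⁺ : ∀ {ℓ} a b → ℓ <∞ a → ℓ <∞ b → ℓ <∞ minLbl a b
<∞-minLbl⁺ nothing  b        _   ℓ<b = ℓ<b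
<∞-minLbl⁺ (just x) nothing  ℓ<a _   = ℓ<a
<∞-minLbl⁺ (just x) (just y) ℓ<a ℓ<b = ⊓-glb ℓ<a ℓ<b

<∞-minLbl⁻ : ∀ {ℓ} a b → ℓ <∞ minLbl a b → ℓ <∞ a × ℓ <∞ b
<∞-minLbl⁻ nothing  b        ℓ<b = tt , ℓ<b
<∞-minLbl⁻ (just x) nothing  ℓ<a = ℓ<a , tt
<∞-minLbl⁻ (just x) (just y) ℓ<m = <-≤-trans ℓ<m (m⊓n≤m x y) , <-≤-trans ℓ<m (m⊓n≤n x y)

module Graph (h : BDD) where
  open BDD h

  dag : LDAG
  dag = bddDAG h

  Reachable : Ptr size → Set
  Reachable = Reach dag

  level : Ptr size → Lvl
  level = LDAG.level dag

  labelOf : Ptr size → Maybe ℕ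
  labelOf = ptrLabel label

  next : Fin size → Bool → Ptr size
  next k b = if b then high k else low k

  ordered-next : ∀ k b → OrderedArc label k (next k b)
  ordered-next k false = proj₁ (ordered k)
  ordered-next k true  = proj₂ (ordered k)

  RootOrChild : Ptr size → Set
  RootOrChild w = (w ≡ root) ⊎ ∃₂ λ k b → Reachable (node k) × next k b ≡ w

  reachable-unfold : ∀ {w} → Reachable w → RootOrChild w
  reachable-unfold reach-root                     = inj₁ refl
  reachable-unfold (reach-step {node k} b r refl) = inj₂ (k , b , r , refl)

  reachable-fold : ∀ {w} → RootOrChild w → Reachable w
  reachable-fold (inj₁ refl)               = reach-root
  reachable-fold (inj₂ (k , b , r , refl)) = reach-step b r refl

  rootOrChild? : ∀ w → (∀ k → OrderedArc label k w → Dec (Reachable (node k))) → Dec (RootOrChild w)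
  rootOrChild? w reachable-parent? = (w ≟ᵖ root) ⊎-dec Fin.any? parent?
    where
    via : ∀ k b → next k b ≡ w → Dec (∃ λ b → Reachable (node k) × next k b ≡ w)
    via k b e = map′ (λ r → b , r , e) (λ (_ , r , _) → r)
                     (reachable-parent? k (subst (OrderedArc label k) e (ordered-next k b)))
    parent? : ∀ k → Dec (∃ λ b → Reachable (node k) × next k b ≡ w)
    parent? k with next k false ≟ᵖ w | next k true ≟ᵖ w
    ... | yes e | _     = via k false e
    ... | no _  | yes e = via k true e
    ... | no e₀ | no e₁ = no λ { (false , _ , e) → e₀ e ; (true , _ , e) → e₁ e }

  -- Parents have smaller labels, so reachability is decided by recursion on a label bound.
  reachable-node? : ∀ n k → label k < n → Dec (Reachable (node k))
  reachable-node? (suc n) k (s≤s lk≤n) = map′ reachable-fold reachable-unfold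
    (rootOrChild? (node k) λ k′ lk′<lk → reachable-node? n k′ (<-≤-trans lk′<lk lk≤n))

  reachable? : ∀ w → Dec (Reachable w)
  reachable? (node k) = reachable-node? (suc (label k)) k ≤-refl
  reachable? (leaf x) = map′ reachable-fold reachable-unfold
    (rootOrChild? (leaf x) λ k _ → reachable? (node k))

  _≟ᵃ_ : DecidableEquality (Arc dag)
  start   ≟ᵃ start   = yes refl
  start   ≟ᵃ out _ _ = no λ ()
  out _ _ ≟ᵃ start   = no λ ()
  out v b ≟ᵃ out w c with v ≟ᵖ w | b Bool.≟ c
  ... | yes refl | yes refl = yes refl
  ... | no v≢w   | _        = no λ { refl → v≢w refl }
  ... | _        | no b≢c   = no λ { refl → b≢c refl }

  private
    pointers : List (Ptr size)
    pointers = leaf false ∷ leaf true ∷ map node (allFin size)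

    ∈-pointers : ∀ v → v ∈ pointers
    ∈-pointers (leaf false) = here refl
    ∈-pointers (leaf true)  = there (here refl)
    ∈-pointers (node k)     = there (there (∈-map⁺ node (∈-allFin k)))

    outArc : Ptr size × Bool → Arc dag
    outArc (v , b) = out v b

    arcsWithDuplicates : List (Arc dag)
    arcsWithDuplicates = start ∷ map outArc (cartesianProduct pointers (false ∷ true ∷ []))

  arcs : List (Arc dag)
  arcs = deduplicate _≟ᵃ_ arcsWithDuplicates

  ∈-arcs : ∀ a → a ∈ arcs
  ∈-arcs start     = ∈-deduplicate⁺ _≟ᵃ_ {xs = arcsWithDuplicates} (here refl)
  ∈-arcs (out v b) = ∈-deduplicate⁺ _≟ᵃ_ {xs = arcsWithDuplicates}
    (there (∈-map⁺ outArc (∈-cartesianProduct⁺ (∈-pointers v) (bool∈ b))))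
    where
    bool∈ : ∀ b → b ∈ false ∷ true ∷ []
    bool∈ false = here refl
    bool∈ true  = there (here refl)

  arcs-unique : Unique arcs
  arcs-unique = UniqueDec.deduplicate-! _≟ᵃ_ arcsWithDuplicates

  ArcInto : ℕ → Ptr size → Arc dag → Set
  ArcInto ℓ v start     = v ≡ root
  ArcInto ℓ v (out u b) = Reachable u × level u <ᴸ ℓ × child dag u b ≡ just v

  arcInto? : ∀ ℓ v a → Dec (ArcInto ℓ v a)
  arcInto? ℓ v start            = v ≟ᵖ root
  arcInto? ℓ v (out (leaf _) b) = no λ ()
  arcInto? ℓ v (out (node k) b) =
    reachable? (node k) ×-dec (label k <? ℓ) ×-dec map′ (cong just) just-injective (next k b ≟ᵖ v)

  arcInto-reachable : ∀ {ℓ v a} → ArcInto ℓ v a → Reachable v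
  arcInto-reachable {a = start}   refl          = reach-root
  arcInto-reachable {a = out u b} (r , _ , e) = reach-step b r e

  arcInto-mono : ∀ {ℓ ℓ′ v a} → ℓ ≤ ℓ′ → ArcInto ℓ v a → ArcInto ℓ′ v a
  arcInto-mono {a = start}          _    v≡root        = v≡root
  arcInto-mono {a = out (node k) b} ℓ≤ℓ′ (r , lk<ℓ , e) = r , <-≤-trans lk<ℓ ℓ≤ℓ′ , e

  EnteredBelow : ℕ → Ptr size → Set
  EnteredBelow ℓ v = ∃ (ArcInto ℓ v)

  HasLabel : ℕ → Ptr size → Set
  HasLabel ℓ p = ∃ λ k → p ≡ node k × label k ≡ ℓ

  hasLabel? : ∀ ℓ p → Dec (HasLabel ℓ p)
  hasLabel? ℓ (leaf _) = no λ { (_ , () , _) }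
  hasLabel? ℓ (node k) = map′ (λ e → k , refl , e) (λ { (_ , refl , e) → e }) (label k ≟ ℓ)

  labelOf-hasLabel : ∀ {ℓ} p → labelOf p ≡ just ℓ → HasLabel ℓ p
  labelOf-hasLabel (node k) e = k , refl , just-injective e

  descend : Bool → ℕ → Ptr size → Ptr size
  descend b ℓ (leaf x) = leaf x
  descend b ℓ (node k) = if label k ≡ᵇ ℓ then next k b else node k

  descend-node : ∀ b {ℓ} k → label k ≡ ℓ → descend b ℓ (node k) ≡ next k b
  descend-node b {ℓ} k e rewrite Equivalence.to Bool.T-≡ (≡⇒≡ᵇ (label k) ℓ e) = refl

  descend-stays : ∀ b ℓ p → ¬ HasLabel ℓ p → descend b ℓ p ≡ p
  descend-stays b ℓ (leaf x) _   = refl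
  descend-stays b ℓ (node k) ¬at with label k ≡ᵇ ℓ in eq
  ... | true  = ⊥-elim (¬at (k , refl , ≡ᵇ⇒≡ (label k) ℓ (Equivalence.from Bool.T-≡ eq)))
  ... | false = refl

  orderedArc-<∞ : ∀ {k} p → OrderedArc label k p → label k <∞ labelOf p
  orderedArc-<∞ (leaf _) _     = tt
  orderedArc-<∞ (node _) lk<lp = lk<lp

  descend-raises : ∀ b ℓ p → ℓ ≤∞ labelOf p → ℓ <∞ labelOf (descend b ℓ p)
  descend-raises b ℓ (leaf _) _ = tt
  descend-raises b ℓ (node k) ℓ≤lk with label k ≟ ℓ
  ... | yes lk≡ℓ rewrite descend-node b k lk≡ℓ =
    subst (_<∞ labelOf (next k b)) lk≡ℓ (orderedArc-<∞ (next k b) (ordered-next k b))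
  ... | no lk≢ℓ rewrite descend-stays b ℓ (node k) (λ { (_ , refl , e) → lk≢ℓ e }) =
    ≤∧≢⇒< ℓ≤lk λ ℓ≡lk → lk≢ℓ (sym ℓ≡lk)

  -- When the product construction takes branch b at level ℓ, an arc of h entering the
  -- resulting component: the b-arc out of p if p is split, else an arc entering p itself.
  EntryArc : ℕ → Bool → Ptr size → Arc dag → Set
  EntryArc ℓ b p r = (HasLabel ℓ p × r ≡ out p b) ⊎ (¬ HasLabel ℓ p × ArcInto ℓ p r)

  entryArc-exists : ∀ b {ℓ p} → EnteredBelow ℓ p →
    ∃ λ r → EntryArc ℓ b p r × ArcInto (suc ℓ) (descend b ℓ p) r
  entryArc-exists b {ℓ} {p} (a , into) with hasLabel? ℓ p
  ... | yes at@(k , refl , e) = out (node k) b , inj₁ (at , refl) ,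
    arcInto-reachable into , s≤s (≤-reflexive e) , cong just (sym (descend-node b k e))
  ... | no ¬at = a , inj₂ (¬at , into) ,
    subst (λ w → ArcInto (suc ℓ) w a) (sym (descend-stays b ℓ p ¬at)) (arcInto-mono (n≤1+n ℓ) into)

  entered-descend : ∀ b {ℓ ℓ′ p} → EnteredBelow ℓ p → ℓ < ℓ′ → EnteredBelow ℓ′ (descend b ℓ p)
  entered-descend b entered ℓ<ℓ′ with entryArc-exists b entered
  ... | r , _ , into = r , arcInto-mono ℓ<ℓ′ into

  entryArc-level-≤ : ∀ {ℓ ℓ′ b b′ p p′ r} → HasLabel ℓ p → EntryArc ℓ b p r → EntryArc ℓ′ b′ p′ r → ℓ ≤ ℓ′
  entryArc-level-≤ at (inj₂ (¬at , _)) _ = ⊥-elim (¬at at)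
  entryArc-level-≤ (_ , refl , e) (inj₁ (_ , refl)) (inj₁ ((_ , refl , e′) , refl)) = ≤-reflexive (trans (sym e) e′)
  entryArc-level-≤ (_ , refl , e) (inj₁ (_ , refl)) (inj₂ (_ , _ , lk<ℓ′ , _))      = <⇒≤ (subst (_< _) e lk<ℓ′)

  entryArc-not-start : ∀ {ℓ b p} → HasLabel ℓ p → ¬ EntryArc ℓ b p start
  entryArc-not-start at (inj₂ (¬at , _)) = ¬at at

  entryArc-unique : ∀ {ℓ b b′ p p′ r} → EntryArc ℓ b p r → EntryArc ℓ b′ p′ r →
    descend b ℓ p ≡ descend b′ ℓ p′ → p ≡ p′ × (HasLabel ℓ p → b ≡ b′)
  entryArc-unique (inj₁ (_ , refl)) (inj₁ (_ , refl)) _ = refl , λ _ → refl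
  entryArc-unique (inj₁ ((_ , refl , e) , refl)) (inj₂ (_ , _ , lk<ℓ , _)) _ = ⊥-elim (<-irrefl e lk<ℓ)
  entryArc-unique (inj₂ (_ , _ , lk<ℓ , _)) (inj₁ ((_ , refl , e) , refl)) _ = ⊥-elim (<-irrefl e lk<ℓ)
  entryArc-unique {ℓ} {b} {b′} {p} {p′} (inj₂ (¬at , _)) (inj₂ (¬at′ , _)) same =
    trans (sym (descend-stays b ℓ p ¬at)) (trans same (descend-stays b′ ℓ p′ ¬at′)) ,
    λ at → ⊥-elim (¬at at)

module LevelCut (h : BDD) (i j : ℕ) where
  open BDD h
  open Graph h

  Incoming : Ptr size → Arc dag → Set
  Incoming = ArcInto (suc j)

  incoming : Ptr size → List (Arc dag)
  incoming v = filter (arcInto? (suc j) v) arcs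

  ∈-incoming⁻ : ∀ {v r} → r ∈ incoming v → Incoming v r
  ∈-incoming⁻ {v} r∈ = proj₂ (∈-filter⁻ (arcInto? (suc j) v) {xs = arcs} r∈)

  ∈-incoming⁺ : ∀ {v r} → Incoming v r → r ∈ incoming v
  ∈-incoming⁺ {v} {r} into = ∈-filter⁺ (arcInto? (suc j) v) (∈-arcs r) into

  -- A node at level j+1 is put on the source side when that does not shrink the cut:
  -- its two outgoing arcs then replace its at most one incoming arc.
  Promoted : Ptr size → Set
  Promoted (leaf _) = ⊥
  Promoted (node k) = i ≡ 2 × label k ≡ suc j × length (incoming (node k)) ≤ 1

  promoted? : ∀ v → Dec (Promoted v)
  promoted? (leaf _) = no λ ()
  promoted? (node k) = (i ≟ 2) ×-dec (label k ≟ suc j) ×-dec (length (incoming (node k)) ≤? 1)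

  OnSourceSide : Vx dag → Set
  OnSourceSide nothing         = ⊤
  OnSourceSide (just (leaf _)) = ⊥
  OnSourceSide (just (node k)) = label k ≤ j ⊎ Promoted (node k)

  onSourceSide? : ∀ x → Dec (OnSourceSide x)
  onSourceSide? nothing         = yes tt
  onSourceSide? (just (leaf _)) = no λ ()
  onSourceSide? (just (node k)) = (label k ≤? j) ⊎-dec promoted? (node k)

  cut : Cut dag
  cut x = does (onSourceSide? x)

  isLevelCut : i ≡ 1 ⊎ i ≡ 2 → IsLevelCut dag i cut
  isLevelCut i≡1⊎2 = j , source-below , target-above
    where
    source-below : ∀ s → InV dag s → cut s ≡ true → levelx dag s <ᴸ (j + i)
    source-below nothing         _ _ = tt
    source-below (just (leaf x)) _ e = ⊥-elim (does-true (onSourceSide? (just (leaf x))) e)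
    source-below (just (node k)) _ e with does-true (onSourceSide? (just (node k))) e
    ... | inj₁ lk≤j = <-≤-trans (s≤s lk≤j) (m<m+n j i>0)
      where
      i>0 : 0 < i
      i>0 = [ (λ i≡1 → subst (0 <_) (sym i≡1) z<s) , (λ i≡2 → subst (0 <_) (sym i≡2) z<s) ] i≡1⊎2
    ... | inj₂ (i≡2 , lk≡1+j , _) =
      subst₂ (λ l n → l < j + n) (sym lk≡1+j) (sym i≡2) (≤-reflexive (+-comm 2 j))
    target-above : ∀ t → InV dag t → cut t ≡ false → j <ᴿ levelx dag t
    target-above nothing         _ ()
    target-above (just (leaf _)) _ _ = tt
    target-above (just (node k)) _ e = ≰⇒> λ lk≤j → does-false (onSourceSide? (just (node k))) e (inj₁ lk≤j)

  crossing? : ∀ a → Dec (Crossing dag cut a)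
  crossing? start            = (cut nothing Bool.≟ true) ×-dec (cut (just root) Bool.≟ false)
  crossing? (out (leaf _) b) = no λ { (_ , _ , () , _) }
  crossing? (out (node k) b) = map′ (λ (r , s , t) → r , next k b , refl , s , t) (λ { (r , _ , refl , s , t) → r , s , t })
    (reachable? (node k) ×-dec (cut (just (node k)) Bool.≟ true) ×-dec (cut (just (next k b)) Bool.≟ false))

  crossing : List (Arc dag)
  crossing = filter crossing? arcs

  ∈-crossing : ∀ {a} → Crossing dag cut a → a ∈ crossing
  ∈-crossing {a} = ∈-filter⁺ crossing? (∈-arcs a)

  cutSize : CutSize dag cut (length crossing)
  cutSize = crossing , Unique.filter⁺ crossing? arcs-unique ,
    (λ a → mk⇔ (λ a∈ → proj₂ (∈-filter⁻ crossing? {xs = arcs} a∈)) ∈-crossing) , refl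

  cut-below : ∀ {k} → label k ≤ j → cut (just (node k)) ≡ true
  cut-below {k} lk≤j = dec-true (onSourceSide? (just (node k))) (inj₁ lk≤j)

  cut-promoted : ∀ {k} → Promoted (node k) → cut (just (node k)) ≡ true
  cut-promoted {k} pr = dec-true (onSourceSide? (just (node k))) (inj₂ pr)

  cut-above : ∀ {v} → ¬ Promoted v → j <ᴿ level v → cut (just v) ≡ false
  cut-above {leaf _} _   _    = refl
  cut-above {node k} ¬pr j<lk = dec-false (onSourceSide? (just (node k))) λ
    { (inj₁ lk≤j) → <⇒≱ j<lk lk≤j ; (inj₂ pr) → ¬pr pr }

  cut-next : ∀ {k} b → label k ≡ suc j → cut (just (next k b)) ≡ false
  cut-next {k} b lk≡1+j with next k b | ordered-next k b
  ... | leaf _  | _      = refl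
  ... | node k′ | lk<lk′ = cut-above (λ (_ , lk′≡1+j , _) → <-irrefl (trans lk≡1+j (sym lk′≡1+j)) lk<lk′)
                                     (<-trans (subst (j <_) (sym lk≡1+j) (n<1+n j)) lk<lk′)

  incoming-crossing : ∀ {v r} → ¬ Promoted v → Incoming v r → j <ᴿ level v → Crossing dag cut r
  incoming-crossing {r = start}          ¬pr refl             j<v = refl , cut-above ¬pr j<v
  incoming-crossing {r = out (node u) b} ¬pr (ru , lu<1+j , e) j<v =
    ru , _ , e , cut-below (≤-pred lu<1+j) , cut-above ¬pr j<v

  two-incoming : ∀ {v} → i ≡ 2 → HasLabel (suc j) v → ¬ Promoted v → 2 ≤ length (incoming v)
  two-incoming i≡2 (_ , refl , lk≡1+j) ¬pr = ≰⇒> λ len≤1 → ¬pr (i≡2 , lk≡1+j , len≤1)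

  -- The crossing arcs charged to a node v of level > j: entered through r, v is charged r
  -- itself, or its low arc if v is promoted; a node at level j+1 is charged two distinct
  -- arcs, selected by a branch b.
  arcEntering : Ptr size → Arc dag → Arc dag
  arcEntering v r = if does (promoted? v) then out v false else r

  arcLeaving : Ptr size → Bool → Arc dag
  arcLeaving v b = if does (promoted? v) then out v b else pick start (incoming v) b

  arcThrough : Ptr size → Bool → Arc dag → Arc dag
  arcThrough v b r = if does (hasLabel? (suc j) v) then arcLeaving v b else arcEntering v r

  incoming-pick : ∀ {v} b → i ≡ 2 → HasLabel (suc j) v → ¬ Promoted v → Incoming v (pick start (incoming v) b)
  incoming-pick {v} b i≡2 at ¬pr = ∈-incoming⁻ (pick-∈ start (incoming v) b (two-incoming i≡2 at ¬pr))

  arcEntering-crossing : ∀ {v r} → Incoming v r → j <ᴿ level v → Crossing dag cut (arcEntering v r)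
  arcEntering-crossing {v} into j<v with promoted? v
  arcEntering-crossing {node k} into j<v | yes pr@(_ , lk≡1+j , _) =
    arcInto-reachable into , next k false , refl , cut-promoted pr , cut-next false lk≡1+j
  ... | no ¬pr = incoming-crossing ¬pr into j<v

  arcLeaving-crossing : ∀ {v} b → i ≡ 2 → HasLabel (suc j) v → Reachable v → Crossing dag cut (arcLeaving v b)
  arcLeaving-crossing {v} b i≡2 at reached with promoted? v
  arcLeaving-crossing {node k} b i≡2 (_ , refl , lk≡1+j) reached | yes pr =
    reached , next k b , refl , cut-promoted pr , cut-next b lk≡1+j
  arcLeaving-crossing {node k} b i≡2 at@(_ , refl , lk≡1+j) reached | no ¬pr =
    incoming-crossing ¬pr (incoming-pick b i≡2 at ¬pr) (subst (j <_) (sym lk≡1+j) (n<1+n j))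

  arcThrough-crossing : ∀ {v r} b → i ≡ 2 → Incoming v r → suc j ≤∞ labelOf v →
    Crossing dag cut (arcThrough v b r)
  arcThrough-crossing {v} b i≡2 into 1+j≤v with hasLabel? (suc j) v
  ... | yes at = arcLeaving-crossing b i≡2 at (arcInto-reachable into)
  arcThrough-crossing {leaf _} b i≡2 into 1+j≤v | no _ = arcEntering-crossing into tt
  arcThrough-crossing {node _} b i≡2 into 1+j≤v | no _ = arcEntering-crossing into 1+j≤v

  -- Recovers the node an image arc is charged to.
  anchor : Arc dag → Maybe (Ptr size)
  anchor start     = just root
  anchor (out v b) = if does (hasLabel? (suc j) v) then just v else child dag v b

  same-anchor : ∀ {a a′ v v′} → anchor a ≡ just v → anchor a′ ≡ just v′ → a ≡ a′ → v ≡ v′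
  same-anchor e e′ refl = just-injective (trans (sym e) e′)

  anchor-out : ∀ {v} b → HasLabel (suc j) v → anchor (out v b) ≡ just v
  anchor-out {v} b at rewrite dec-true (hasLabel? (suc j) v) at = refl

  anchor-incoming : ∀ {v r} → Incoming v r → anchor r ≡ just v
  anchor-incoming {r = start}     refl              = refl
  anchor-incoming {r = out u b}   (_ , lu<1+j , e) with hasLabel? (suc j) u
  ... | yes (_ , refl , lu≡1+j) = ⊥-elim (<-irrefl lu≡1+j lu<1+j)
  ... | no _                    = e

  anchor-arcEntering : ∀ {v r} → Incoming v r → anchor (arcEntering v r) ≡ just v
  anchor-arcEntering {v} into with promoted? v
  anchor-arcEntering {node k} into | yes (_ , lk≡1+j , _) = anchor-out false (k , refl , lk≡1+j)
  ... | no _ = anchor-incoming into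

  anchor-arcLeaving : ∀ {v} b → i ≡ 2 → HasLabel (suc j) v → anchor (arcLeaving v b) ≡ just v
  anchor-arcLeaving {v} b i≡2 at with promoted? v
  ... | yes _  = anchor-out b at
  ... | no ¬pr = anchor-incoming (incoming-pick b i≡2 at ¬pr)

  anchor-arcThrough : ∀ {v r} b → i ≡ 2 → Incoming v r → anchor (arcThrough v b r) ≡ just v
  anchor-arcThrough {v} b i≡2 into with hasLabel? (suc j) v
  ... | yes at = anchor-arcLeaving b i≡2 at
  ... | no _   = anchor-arcEntering into

  arcEntering-injective : ∀ {v r r′} → Incoming v r → Incoming v r′ → arcEntering v r ≡ arcEntering v r′ → r ≡ r′
  arcEntering-injective {v} into into′ same with promoted? v
  arcEntering-injective {node k} into into′ same | yes (_ , _ , len≤1) =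
    ∈-length≤1 len≤1 (∈-incoming⁺ into) (∈-incoming⁺ into′)
  ... | no _ = same

  arcLeaving-injective : ∀ {v} b b′ → i ≡ 2 → HasLabel (suc j) v → arcLeaving v b ≡ arcLeaving v b′ → b ≡ b′
  arcLeaving-injective {v} b b′ i≡2 at same with promoted? v
  ... | yes _  = cong (λ { start → b ; (out _ c) → c }) same
  ... | no ¬pr = pick-injective start (incoming v) (Unique.filter⁺ (arcInto? (suc j) v) arcs-unique)
                   (two-incoming i≡2 at ¬pr) b b′ same

  arcThrough-injective : ∀ {v r r′} b b′ → i ≡ 2 → HasLabel (suc j) v → arcThrough v b r ≡ arcThrough v b′ r′ → b ≡ b′
  arcThrough-injective {v} b b′ i≡2 at same with hasLabel? (suc j) v
  ... | yes _  = arcLeaving-injective b b′ i≡2 at same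
  ... | no ¬at = ⊥-elim (¬at at)

module Product (f g : BDD) (op : Bool → Bool → Bool) where
  module F = Graph f
  module G = Graph g

  dag : LDAG
  dag = applyDAG f g op

  labelᵖ : Ptr (BDD.size f) → Ptr (BDD.size g) → Maybe ℕ
  labelᵖ = pairLabel f g op

  embedᵖ : Ptr (BDD.size f) → Ptr (BDD.size g) → OutNode f g op
  embedᵖ = embed f g op

  stepF-descend : ∀ b ℓ p → stepF f g op b ℓ p ≡ F.descend b ℓ p
  stepF-descend b ℓ (leaf _) = refl
  stepF-descend b ℓ (node _) = refl

  stepG-descend : ∀ b ℓ q → stepG f g op b ℓ q ≡ G.descend b ℓ q
  stepG-descend b ℓ (leaf _) = refl
  stepG-descend b ℓ (node _) = refl

  child-pair : ∀ {p q ℓ} b → labelᵖ p q ≡ just ℓ →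
    child dag (pair p q) b ≡ just (embedᵖ (F.descend b ℓ p) (G.descend b ℓ q))
  child-pair {p} {q} {ℓ} false pl rewrite pl | stepF-descend false ℓ p | stepG-descend false ℓ q = refl
  child-pair {p} {q} {ℓ} true  pl rewrite pl | stepF-descend true  ℓ p | stepG-descend true  ℓ q = refl

  child-pair-nothing : ∀ {p q} b → labelᵖ p q ≡ nothing → child dag (pair p q) b ≡ nothing
  child-pair-nothing b pl rewrite pl = refl

  child-pair-inv : ∀ {p q w} b → child dag (pair p q) b ≡ just w →
    ∃ λ ℓ → labelᵖ p q ≡ just ℓ × w ≡ embedᵖ (F.descend b ℓ p) (G.descend b ℓ q)
  child-pair-inv {p} {q} {w} b e = cases (labelᵖ p q) refl
    where
    cases : ∀ m → labelᵖ p q ≡ m → ∃ λ ℓ → labelᵖ p q ≡ just ℓ × w ≡ embedᵖ (F.descend b ℓ p) (G.descend b ℓ q)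
    cases (just ℓ) pl = ℓ , pl , just-injective (trans (sym e) (child-pair b pl))
    cases nothing  pl with () ← trans (sym (child-pair-nothing b pl)) e

  embed-pair : ∀ {p q ℓ} → labelᵖ p q ≡ just ℓ → embedᵖ p q ≡ pair p q
  embed-pair {leaf _} {leaf _} ()
  embed-pair {leaf _} {node _} _ = refl
  embed-pair {node _} {leaf _} _ = refl
  embed-pair {node _} {node _} _ = refl

  split-component : ∀ {p q ℓ} → labelᵖ p q ≡ just ℓ → F.HasLabel ℓ p ⊎ G.HasLabel ℓ q
  split-component {p} {q} pl with minLbl-sel (F.labelOf p) (G.labelOf q) pl
  ... | inj₁ lp≡ℓ = inj₁ (F.labelOf-hasLabel p lp≡ℓ)
  ... | inj₂ lq≡ℓ = inj₂ (G.labelOf-hasLabel q lq≡ℓ)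

  level-embed : ∀ {j} p q → j <ᴿ outLevel f g op (embedᵖ p q) → j <ᴿ F.level p × j <ᴿ G.level q
  level-embed (leaf _) (leaf _) _ = tt , tt
  level-embed (leaf x) (node k) j< = <∞-minLbl⁻ (F.labelOf (leaf x)) (G.labelOf (node k)) j<
  level-embed (node k) (leaf x) j< = <∞-minLbl⁻ (F.labelOf (node k)) (G.labelOf (leaf x)) j<
  level-embed (node k) (node l) j< = <∞-minLbl⁻ (F.labelOf (node k)) (G.labelOf (node l)) j<

  PairEntered : OutNode f g op → Set
  PairEntered (term _)   = ⊤
  PairEntered (pair p q) = ∀ {ℓ} → labelᵖ p q ≡ just ℓ → F.EnteredBelow ℓ p × G.EnteredBelow ℓ q

  pairEntered-embed : ∀ p q → PairEntered (pair p q) → PairEntered (embedᵖ p q)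
  pairEntered-embed (leaf _) (leaf _) _ = tt
  pairEntered-embed (leaf _) (node _) e = e
  pairEntered-embed (node _) (leaf _) e = e
  pairEntered-embed (node _) (node _) e = e

  reachable-pairEntered : ∀ {o} → Reach dag o → PairEntered o
  reachable-pairEntered reach-root =
    pairEntered-embed (BDD.root f) (BDD.root g) λ _ → (start , refl) , (start , refl)
  reachable-pairEntered (reach-step {term _} b _ ())
  reachable-pairEntered (reach-step {pair p q} b reached ce) with child-pair-inv b ce
  ... | ℓ , pl , refl = pairEntered-embed p′ q′ λ pl′ →
    F.entered-descend b (proj₁ (entered pl)) (ℓ<ℓ′ pl′) , G.entered-descend b (proj₂ (entered pl)) (ℓ<ℓ′ pl′)
    where
    p′ : Ptr (BDD.size f)
    p′ = F.descend b ℓ p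
    q′ : Ptr (BDD.size g)
    q′ = G.descend b ℓ q
    entered : PairEntered (pair p q)
    entered = reachable-pairEntered reached
    ℓ<ℓ′ : ∀ {ℓ′} → labelᵖ p′ q′ ≡ just ℓ′ → ℓ < ℓ′
    ℓ<ℓ′ pl′ with minLbl-≤∞ (F.labelOf p) (G.labelOf q) pl
    ... | ℓ≤p , ℓ≤q = subst (ℓ <∞_) pl′
      (<∞-minLbl⁺ (F.labelOf p′) (G.labelOf q′) (F.descend-raises b ℓ p ℓ≤p) (G.descend-raises b ℓ q ℓ≤q))

module Charging (f g : BDD) (op : Bool → Bool → Bool) (i j : ℕ) (cut : Cut (applyDAG f g op)) where
  open Product f g op
  module Cf = LevelCut f i j
  module Cg = LevelCut g i j

  -- α leads to the product node with components p′, q′, which rf and rg enter in f and g.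
  data Entry (p′ : Ptr (BDD.size f)) (q′ : Ptr (BDD.size g)) : Arc dag → Arc F.dag → Arc G.dag → Set where
    at-root : p′ ≡ BDD.root f → q′ ≡ BDD.root g → Entry p′ q′ start start start
    at-step : ∀ {p q b ℓ rf rg} → labelᵖ p q ≡ just ℓ → F.EntryArc ℓ b p rf → G.EntryArc ℓ b q rg →
              p′ ≡ F.descend b ℓ p → q′ ≡ G.descend b ℓ q → Entry p′ q′ (out (pair p q) b) rf rg

  step-level-≤ : ∀ {p q b ℓ rf rg p₂ q₂ b₂ ℓ₂} → labelᵖ p q ≡ just ℓ →
    F.EntryArc ℓ b p rf → G.EntryArc ℓ b q rg → F.EntryArc ℓ₂ b₂ p₂ rf → G.EntryArc ℓ₂ b₂ q₂ rg → ℓ ≤ ℓ₂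
  step-level-≤ pl ef eg ef₂ eg₂ with split-component pl
  ... | inj₁ at = F.entryArc-level-≤ at ef ef₂
  ... | inj₂ at = G.entryArc-level-≤ at eg eg₂

  entry-injective : ∀ {p′ q′ α α′ rf rg} → Entry p′ q′ α rf rg → Entry p′ q′ α′ rf rg → α ≡ α′
  entry-injective (at-root _ _) (at-root _ _) = refl
  entry-injective (at-root _ _) (at-step pl ef eg _ _) with split-component pl
  ... | inj₁ at = ⊥-elim (F.entryArc-not-start at ef)
  ... | inj₂ at = ⊥-elim (G.entryArc-not-start at eg)
  entry-injective (at-step pl ef eg _ _) (at-root _ _) with split-component pl
  ... | inj₁ at = ⊥-elim (F.entryArc-not-start at ef)
  ... | inj₂ at = ⊥-elim (G.entryArc-not-start at eg)
  entry-injective (at-step pl ef eg p′≡ q′≡) (at-step pl₂ ef₂ eg₂ p′≡₂ q′≡₂)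
    with ≤-antisym (step-level-≤ pl ef eg ef₂ eg₂) (step-level-≤ pl₂ ef₂ eg₂ ef eg)
  ... | refl with F.entryArc-unique ef ef₂ (trans (sym p′≡) p′≡₂) | G.entryArc-unique eg eg₂ (trans (sym q′≡) q′≡₂)
  ...   | refl , same-bᶠ | refl , same-bᵍ = cong (out _) ([ same-bᶠ , same-bᵍ ] (split-component pl))

  -- An arc crossing the cut is charged to a pair of crossing arcs of f and g: through the
  -- components of its target, or, when its source lies at level j+1, through those of its source.
  data Charge (α : Arc dag) (x : Arc F.dag × Arc G.dag) : Set where
    via-target : ∀ {p′ q′ rf rg} → Entry p′ q′ α rf rg → cut (just (embedᵖ p′ q′)) ≡ false →
      Cf.Incoming p′ rf → Cg.Incoming q′ rg → x ≡ (Cf.arcEntering p′ rf , Cg.arcEntering q′ rg) → Charge α x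
    via-source : ∀ {p q b rf rg} → i ≡ 2 → α ≡ out (pair p q) b → labelᵖ p q ≡ just (suc j) →
      cut (just (pair p q)) ≡ true → Cf.Incoming p rf → Cg.Incoming q rg →
      x ≡ (Cf.arcThrough p b rf , Cg.arcThrough q b rg) → Charge α x

  target-not-source : ∀ {p′ q′ rf rg p q b rf₂ rg₂} → i ≡ 2 → labelᵖ p q ≡ just (suc j) →
    cut (just (embedᵖ p′ q′)) ≡ false → cut (just (pair p q)) ≡ true →
    Cf.Incoming p′ rf → Cg.Incoming q′ rg → Cf.Incoming p rf₂ → Cg.Incoming q rg₂ →
    (Cf.arcEntering p′ rf , Cg.arcEntering q′ rg) ≢ (Cf.arcThrough p b rf₂ , Cg.arcThrough q b rg₂)
  target-not-source {b = b} i≡2 pl tgt-out src-in inf ing inf₂ ing₂ same with ,-injective same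
  ... | sf , sg with Cf.same-anchor (Cf.anchor-arcEntering inf) (Cf.anchor-arcThrough b i≡2 inf₂) sf
                   | Cg.same-anchor (Cg.anchor-arcEntering ing) (Cg.anchor-arcThrough b i≡2 ing₂) sg
  ... | refl | refl with trans (sym tgt-out) (trans (cong (λ o → cut (just o)) (embed-pair pl)) src-in)
  ... | ()

  charge-injective : ∀ {α α′ x} → Charge α x → Charge α′ x → α ≡ α′
  charge-injective (via-target e _ inf ing refl) (via-target e′ _ inf′ ing′ same) with ,-injective same
  ... | sf , sg with Cf.same-anchor (Cf.anchor-arcEntering inf) (Cf.anchor-arcEntering inf′) sf
                   | Cg.same-anchor (Cg.anchor-arcEntering ing) (Cg.anchor-arcEntering ing′) sg
  ... | refl | refl with Cf.arcEntering-injective inf inf′ sf | Cg.arcEntering-injective ing ing′ sg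
  ... | refl | refl = entry-injective e e′
  charge-injective (via-source {p} {q} {b} {rf} {rg} i≡2 refl pl _ inf ing refl)
                   (via-source {b = b′} {rf′} {rg′} _ refl _ _ inf′ ing′ same)
    with ,-injective same
  ... | sf , sg with Cf.same-anchor (Cf.anchor-arcThrough b i≡2 inf) (Cf.anchor-arcThrough b′ i≡2 inf′) sf
                   | Cg.same-anchor (Cg.anchor-arcThrough b i≡2 ing) (Cg.anchor-arcThrough b′ i≡2 ing′) sg
  ... | refl | refl with split-component {p} {q} pl
  ...   | inj₁ at = cong (out _) (Cf.arcThrough-injective {r = rf} {rf′} b b′ i≡2 at sf)
  ...   | inj₂ at = cong (out _) (Cg.arcThrough-injective {r = rg} {rg′} b b′ i≡2 at sg)
  charge-injective (via-target _ tgt-out inf ing refl) (via-source i≡2 _ pl src-in inf₂ ing₂ same) =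
    ⊥-elim (target-not-source i≡2 pl tgt-out src-in inf ing inf₂ ing₂ same)
  charge-injective (via-source i≡2 _ pl src-in inf₂ ing₂ refl) (via-target _ tgt-out inf ing same) =
    ⊥-elim (target-not-source i≡2 pl tgt-out src-in inf ing inf₂ ing₂ (sym same))

  SourcesBelow TargetsAbove : Set
  SourcesBelow = ∀ s → InV dag s → cut s ≡ true  → levelx dag s <ᴸ (j + i)
  TargetsAbove = ∀ t → InV dag t → cut t ≡ false → j <ᴿ levelx dag t

  Charged : Arc dag → Set
  Charged α = ∃ λ x → Charge α x × x ∈ cartesianProduct Cf.crossing Cg.crossing

  charged-by-target : ∀ {α p′ q′ rf rg} → TargetsAbove →
    Entry p′ q′ α rf rg → Reach dag (embedᵖ p′ q′) → cut (just (embedᵖ p′ q′)) ≡ false →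
    Cf.Incoming p′ rf → Cg.Incoming q′ rg → Charged α
  charged-by-target {p′ = p′} {q′} above e reached tgt-out inf ing
    with level-embed p′ q′ (above (just (embedᵖ p′ q′)) reached tgt-out)
  ... | j<p′ , j<q′ = _ , via-target e tgt-out inf ing refl ,
    ∈-cartesianProduct⁺ (Cf.∈-crossing (Cf.arcEntering-crossing inf j<p′)) (Cg.∈-crossing (Cg.arcEntering-crossing ing j<q′))

  step-charged-by-target : ∀ {p q ℓ} b → TargetsAbove → Reach dag (pair p q) → labelᵖ p q ≡ just ℓ → ℓ ≤ j →
    cut (just (embedᵖ (F.descend b ℓ p) (G.descend b ℓ q))) ≡ false → Charged (out (pair p q) b)
  step-charged-by-target b above reached pl ℓ≤j tgt-out with reachable-pairEntered reached pl
  ... | enteredᶠ , enteredᵍ with F.entryArc-exists b enteredᶠ | G.entryArc-exists b enteredᵍ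
  ... | _ , ef , inf | _ , eg , ing =
    charged-by-target above (at-step pl ef eg refl refl) (reach-step b reached (child-pair b pl)) tgt-out
      (F.arcInto-mono (s≤s ℓ≤j) inf) (G.arcInto-mono (s≤s ℓ≤j) ing)

  step-charged-by-source : ∀ {p q} b → i ≡ 2 → Reach dag (pair p q) → labelᵖ p q ≡ just (suc j) →
    cut (just (pair p q)) ≡ true → Charged (out (pair p q) b)
  step-charged-by-source {p} {q} b i≡2 reached pl src-in
    with reachable-pairEntered reached pl | minLbl-≤∞ (F.labelOf p) (G.labelOf q) pl
  ... | (_ , inf) , (_ , ing) | 1+j≤p , 1+j≤q = _ , via-source i≡2 refl pl src-in inf ing refl ,
    ∈-cartesianProduct⁺ (Cf.∈-crossing (Cf.arcThrough-crossing b i≡2 inf 1+j≤p))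
                        (Cg.∈-crossing (Cg.arcThrough-crossing b i≡2 ing 1+j≤q))

  crossing-charged : i ≡ 1 ⊎ i ≡ 2 → SourcesBelow → TargetsAbove → ∀ {α} → Crossing dag cut α → Charged α
  crossing-charged _ _ above {start} (_ , tgt-out) =
    charged-by-target above (at-root refl refl) reach-root tgt-out refl refl
  crossing-charged _ _ _ {out (term _) _} (_ , _ , () , _)
  crossing-charged i≡1⊎2 below above {out (pair p q) b} (reached , _ , ce , src-in , tgt-out)
    with child-pair-inv b ce
  ... | ℓ , pl , refl with ℓ ≤? j
  ...   | yes ℓ≤j = step-charged-by-target b above reached pl ℓ≤j tgt-out
  ...   | no ℓ≰j with between-levels i≡1⊎2 (subst (λ m → toLvl m <ᴸ (j + i)) pl (below _ reached src-in)) ℓ≰j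
  ...     | i≡2 , refl = step-charged-by-source b i≡2 reached pl src-in

  cutSize-≤ : i ≡ 1 ⊎ i ≡ 2 → SourcesBelow → TargetsAbove → ∀ {c} → CutSize dag cut c →
    c ≤ length Cf.crossing * length Cg.crossing
  cutSize-≤ i≡1⊎2 below above (arcs , unique , ∈⇔ , refl) = begin
    length arcs                                          ≤⟨ length-≤-injective Charge arcs _ unique
                                                              (λ α∈ → crossing-charged i≡1⊎2 below above (Equivalence.to (∈⇔ _) α∈))
                                                              charge-injective ⟩
    length (cartesianProduct Cf.crossing Cg.crossing)  ≡⟨ length-cartesianProduct Cf.crossing Cg.crossing ⟩
    length Cf.crossing * length Cg.crossing              ∎
    where open ≤-Reasoning

theorem2 : (f g : BDD) (op : Bool → Bool → Bool) (i : ℕ) → (i ≡ 1) ⊎ (i ≡ 2) →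
    (cf cg c : ℕ) →
    IsMaxLevelCut (bddDAG f) i cf →
    IsMaxLevelCut (bddDAG g) i cg →
    IsMaxLevelCut (applyDAG f g op) i c →
    c ≤ cf * cg
theorem2 f g op i i≡1⊎2 cf cg c (_ , f-max) (_ , g-max) ((cut , (j , below , above) , size) , _) = begin
  c                                        ≤⟨ cutSize-≤ i≡1⊎2 below above size ⟩
  length Cf.crossing * length Cg.crossing  ≤⟨ *-mono-≤ (f-max Cf.cut _ (Cf.isLevelCut i≡1⊎2) Cf.cutSize)
                                                        (g-max Cg.cut _ (Cg.isLevelCut i≡1⊎2) Cg.cutSize) ⟩
  cf * cg                                  ∎
  where
  open ≤-Reasoning
  open Charging f g op i j cut
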